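{- Let $t\ge 3$ and $n\ge 2t+17$ be integers, and let $H$ be a 3-graph on $n$ vertices with $\delta_1(H)\ge g(n,t)$, where $$g(n,t)=\begin{cases}\frac{t-1}{2}n+\frac32 t^3-\frac92 t+6 & t \text{ odd},\\ \frac{t-2}{2}n+\frac32 t^3-\frac52 t+6 & t\text{ even}.\end{cases}$$ Suppose $H$ contains no linear path of length $t+1$, and let $P=(x_0,x_1,\dots,x_{2t})$ be a linear path of length $t$ in $H$. Then: (i) $d_P(0,2t)\le 1$; (ii) if for some $k\in[0,t-1]$ both $d_P(0,2k+1)>0$ and $d_P(2t,2k+1)>0$, then $d_P(0,2k+1)+d_P(2t,2k+1)\le 2$; (iii) if for some $k\in[0,t-1]$ we have $d_P(0,2k+2)>0$ and $d_P(2t,2k)>0$, then $d_P(0,2k+2)+d_P(2t,2k)\le 4$; (iv) if for some $k\in[0,t-1]$ and some $\ell\in\{0,t\}$ we have $d_P(2k,2k+2)>0$ and $d_P(2\ell,2k+1)>0$, then $d_P(2k,2k+2)+d_P(2\ell,2k+1)\le 2$.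
   Context: A 3-graph is a simple 3-uniform hypergraph; $\delta_1(H)$ is the minimum over vertices of the number of edges containing the vertex. A linear path of length $k$ is a collection of $k$ edges $e_1,\dots,e_k$ with $|e_i\cap e_j|=1$ if $|i-j|=1$ and $e_i\cap e_j=\emptyset$ otherwise. The notation $P=(x_0,x_1,\dots,x_{2t})$ means the linear path with edges $\{x_0,x_1,x_2\},\{x_2,x_3,x_4\},\dots,\{x_{2t-2},x_{2t-1},x_{2t}\}$ (distinct vertices $x_i$). For distinct $a,b\in\{0,\dots,2t\}$, $d_P(a,b)$ denotes the number of vertices $y\notin V(P)$ such that $\{x_a,x_b,y\}\in E(H)$. For integers $a<b$, $[a,b]=\{a,a+1,\dots,b\}$. -}

module Defs where

open import Data.Nat using (ℕ; zero; suc; _+_; _*_; _∸_; _^_; _≤_; _<_; _%_)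
open import Data.Fin using (Fin; toℕ)
open import Data.Fin.Properties using () renaming (_≟_ to _≟ᶠ_)
open import Data.Nat.Properties using (_<?_)
open import Data.Bool using (Bool; true; false; _∧_; not; if_then_else_)
open import Data.List using (List; map; upTo; allFin)
open import Data.Nat.ListAction using (sum)
open import Data.Bool.ListAction using (any)
open import Data.Product using (_×_)
open import Relation.Nullary.Decidable using (⌊_⌋)
open import Relation.Binary.PropositionalEquality using (_≡_; _≢_)

record 3Graph (n : ℕ) : Set where
  field
    edge     : Fin n → Fin n → Fin n → Bool
    sym₁₂    : ∀ a b c → edge a b c ≡ edge b a c
    sym₂₃    : ∀ a b c → edge a b c ≡ edge a c b
    distinct : ∀ a b c → edge a b c ≡ true → (a ≢ b) × (b ≢ c) × (a ≢ c)
open 3Graph public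

countFin : (n : ℕ) → (Fin n → Bool) → ℕ
countFin n p = sum (map (λ y → if p y then 1 else 0) (allFin n))

-- degree of v: the number of edges {v,b,c} containing v, counting each
-- unordered pair {b,c} once (via toℕ b < toℕ c)
deg : ∀ {n} → 3Graph n → Fin n → ℕ
deg {n} H v = sum (map (λ b → countFin n (λ c → ⌊ toℕ b <? toℕ c ⌋ ∧ edge H v b c)) (allFin n))

-- twiceG n t = 2 · g(n,t); for t ≥ 3 the truncated subtraction is exact.
twiceG : ℕ → ℕ → ℕ
twiceG n t with t % 2
... | 1 = (t ∸ 1) * n + (3 * t ^ 3 + 12 ∸ 9 * t)
... | _ = (t ∸ 2) * n + (3 * t ^ 3 + 12 ∸ 5 * t)

-- x : ℕ → Fin n, with x 0, …, x (2k) the vertex sequence, is the linear path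
-- (x_0,…,x_{2k}) of length k in H: distinct vertices, and edges
-- {x_{2i}, x_{2i+1}, x_{2i+2}} for i < k.
IsLinearPath : ∀ {n} → 3Graph n → ℕ → (ℕ → Fin n) → Set
IsLinearPath H k x =
  (∀ i j → i ≤ 2 * k → j ≤ 2 * k → x i ≡ x j → i ≡ j) ×
  (∀ i → i < k → edge H (x (2 * i)) (x (2 * i + 1)) (x (2 * i + 2)) ≡ true)

inPath : ∀ {n} → ℕ → (ℕ → Fin n) → Fin n → Bool
inPath t x y = any (λ i → ⌊ x i ≟ᶠ y ⌋) (upTo (suc (2 * t)))

dP : ∀ {n} → 3Graph n → ℕ → (ℕ → Fin n) → ℕ → ℕ → ℕ
dP {n} H t x a b = countFin n (λ y → edge H (x a) (x b) y ∧ not (inPath t x y))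

module Submission where

-- A linear cycle C of length t + 1 has only 2(t + 1) vertices, and g(n, t) > 2(t + 1)² for t ≥ 3.
-- Suppose a vertex y₂ outside C could replace a vertex y₁ of C lying in a single edge of C.  Then
-- every edge at y₂ lies inside V(C): an edge {y₂ , b , c} with c ∈ C and b ∉ C is a pendant edge
-- of C, one with b , c ∉ C is a pendant edge of the cycle through y₂, and a (t + 1)-cycle with a
-- pendant edge contains a linear path of length t + 1.  So 2·deg(y₂) ≤ |V(C)|² < 2·g(n, t), which
-- is impossible.  Each of (i)–(iv) is proved by contradiction from distinct vertices counted by the
-- d_P's: in (ii) and (iv) they extend P directly to a linear path of length t + 1, in (i) and (iii)
-- they close P (without x_{2k+1} in (iii)) into a (t + 1)-cycle with such a replaceable vertex.

open import Defs
open import Data.Bool using (Bool; true; false; T; _∧_; _∨_; not; if_then_else_)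
open import Data.Empty using (⊥)
open import Data.Fin using (Fin; toℕ)
open import Data.Fin.Properties using (_≟_)
open import Data.List using (List; []; _∷_; _++_; _∷ʳ_; [_]; map; length; allFin; InitLast; initLast; _∷ʳ′_)
open import Data.List.Properties using (length-++; ++-assoc)
open import Data.List.Membership.Propositional using (_∈_; _∉_)
open import Data.List.Membership.Propositional.Properties using (∈-++⁺ʳ; ∈-upTo⁺)
open import Data.List.Relation.Unary.All using (All; []; _∷_)
import Data.List.Relation.Unary.All as All
open import Data.List.Relation.Unary.All.Properties using (¬Any⇒All¬; All¬⇒¬Any)
import Data.List.Relation.Unary.AllPairs as AllPairs
open import Data.List.Relation.Unary.Any using (here; there)
import Data.List.Relation.Unary.Any as Any
open import Data.List.Relation.Unary.Any.Properties using (any⁺)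
open import Data.List.Relation.Unary.Unique.Propositional using (Unique; []; _∷_)
open import Data.List.Relation.Unary.Unique.Propositional.Properties using (allFin⁺) renaming (++⁺ to Unique-++⁺)
open import Data.List.Relation.Binary.Permutation.Propositional
  using (_↭_; ↭-refl; ↭-reflexive; ↭-sym; ↭-prep; ↭-swap; ↭⇒↭ₛ; module PermutationReasoning)
open import Data.List.Relation.Binary.Permutation.Propositional.Properties
  using (∈-resp-↭; ++⁺; ++⁺ˡ; ++-commutativeMonoid)
import Data.List.Relation.Binary.Permutation.Setoid.Properties as PermutationSetoid
open import Data.Nat using (ℕ; zero; suc; _+_; _*_; _∸_; _^_; _≤_; _<_; _%_; z≤n; s≤s; _<?_)
open import Data.Nat.ListAction using (sum)
open import Data.Nat.Properties hiding (_≟_)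
open import Data.Nat.Tactic.RingSolver using (solve-∀)
open import Data.Product using (Σ; ∃; _×_; _,_; proj₁; proj₂)
open import Data.Sum using (_⊎_; inj₁; inj₂)
open import Data.Unit using (⊤; tt)
open import Function using (_∘_)
open import Relation.Binary.Definitions using (DecidableEquality)
open import Relation.Binary.PropositionalEquality hiding ([_])
open import Relation.Nullary using (¬_; yes; no; does; contradiction)
open import Relation.Nullary.Decidable using (⌊_⌋; dec-true; dec-false; fromWitness)

𝟙 : Bool → ℕ
𝟙 b = if b then 1 else 0

𝟙-∨ : ∀ a b → 𝟙 (a ∨ b) ≤ 𝟙 a + 𝟙 b
𝟙-∨ false b     = ≤-refl
𝟙-∨ true  false = ≤-refl
𝟙-∨ true  true  = s≤s z≤n

𝟙-≤-∧-not : ∀ a b → 𝟙 a ≤ 𝟙 b + 𝟙 (a ∧ not b)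
𝟙-≤-∧-not false b     = z≤n
𝟙-≤-∧-not true  false = ≤-refl
𝟙-≤-∧-not true  true  = ≤-refl

sumMap : ∀ {A : Set} → List A → (A → ℕ) → ℕ
sumMap xs f = sum (map f xs)

module _ {A : Set} where

  sumMap-zero : (xs : List A) → sumMap xs (λ _ → 0) ≡ 0
  sumMap-zero []       = refl
  sumMap-zero (_ ∷ xs) = sumMap-zero xs

  sumMap-+ : ∀ (xs : List A) (f g : A → ℕ) →
    sumMap xs (λ a → f a + g a) ≡ sumMap xs f + sumMap xs g
  sumMap-+ []       f g = refl
  sumMap-+ (a ∷ xs) f g rewrite sumMap-+ xs f g = interchange (f a) (g a) (sumMap xs f) (sumMap xs g)
    where
    interchange : ∀ a b c d → a + b + (c + d) ≡ a + c + (b + d)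
    interchange = solve-∀

  sumMap-*ˡ : ∀ (xs : List A) k (f : A → ℕ) → sumMap xs (λ a → k * f a) ≡ k * sumMap xs f
  sumMap-*ˡ []       k f = sym (*-zeroʳ k)
  sumMap-*ˡ (a ∷ xs) k f rewrite sumMap-*ˡ xs k f = sym (*-distribˡ-+ k (f a) (sumMap xs f))

  sumMap-*ʳ : ∀ (xs : List A) k (f : A → ℕ) → sumMap xs (λ a → f a * k) ≡ sumMap xs f * k
  sumMap-*ʳ []       k f = refl
  sumMap-*ʳ (a ∷ xs) k f rewrite sumMap-*ʳ xs k f = sym (*-distribʳ-+ k (f a) (sumMap xs f))

  sumMap-mono : ∀ (xs : List A) {f g : A → ℕ} → (∀ a → f a ≤ g a) → sumMap xs f ≤ sumMap xs g
  sumMap-mono []       f≤g = z≤n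
  sumMap-mono (a ∷ xs) f≤g = +-mono-≤ (f≤g a) (sumMap-mono xs f≤g)

  sumMap-cong : ∀ (xs : List A) {f g : A → ℕ} → (∀ a → f a ≡ g a) → sumMap xs f ≡ sumMap xs g
  sumMap-cong []       f≗g = refl
  sumMap-cong (a ∷ xs) f≗g = cong₂ _+_ (f≗g a) (sumMap-cong xs f≗g)

  sumMap-𝟙-pos⇒∃ : ∀ (xs : List A) (p : A → Bool) → 0 < sumMap xs (𝟙 ∘ p) → ∃ λ a → p a ≡ true
  sumMap-𝟙-pos⇒∃ (a ∷ xs) p pos with p a in pa
  ... | true  = a , pa
  ... | false = sumMap-𝟙-pos⇒∃ xs p pos

sumMap-comm : ∀ {A B : Set} (xs : List A) (ys : List B) (f : A → B → ℕ) →
  sumMap xs (λ a → sumMap ys (f a)) ≡ sumMap ys (λ b → sumMap xs (λ a → f a b))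
sumMap-comm []       ys f = sym (sumMap-zero ys)
sumMap-comm (a ∷ xs) ys f rewrite sumMap-comm xs ys f =
  sym (sumMap-+ ys (f a) (λ b → sumMap xs (λ a → f a b)))

module _ {A : Set} (_≟ᴬ_ : DecidableEquality A) where
  open import Data.List.Membership.DecPropositional _≟ᴬ_ using (_∈?_)

  sumMap-𝟙-≟-unique : ∀ (xs : List A) w → Unique xs →
    sumMap xs (λ y → 𝟙 (does (y ≟ᴬ w))) ≤ 1
  sumMap-𝟙-≟-unique []       w u = z≤n
  sumMap-𝟙-≟-unique (a ∷ xs) w (a∉xs ∷ u) with a ≟ᴬ w
  ... | no  _    = sumMap-𝟙-≟-unique xs w u
  ... | yes refl = ≤-reflexive (cong suc (sumMap-zero-≟ xs a∉xs))
    where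
    sumMap-zero-≟ : ∀ ys → All (a ≢_) ys → sumMap ys (λ y → 𝟙 (does (y ≟ᴬ a))) ≡ 0
    sumMap-zero-≟ []       _          = refl
    sumMap-zero-≟ (y ∷ ys) (a≢y ∷ as) rewrite dec-false (y ≟ᴬ a) (a≢y ∘ sym) =
      sumMap-zero-≟ ys as

  sumMap-𝟙-∈-unique : ∀ (xs : List A) W → Unique xs →
    sumMap xs (λ y → 𝟙 (does (y ∈? W))) ≤ length W
  sumMap-𝟙-∈-unique xs []       u = ≤-reflexive (sumMap-zero xs)
  sumMap-𝟙-∈-unique xs (w ∷ W) u = begin
      sumMap xs (λ y → 𝟙 (does (y ≟ᴬ w) ∨ does (y ∈? W)))
    ≤⟨ sumMap-mono xs (λ y → 𝟙-∨ (does (y ≟ᴬ w)) (does (y ∈? W))) ⟩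
      sumMap xs (λ y → 𝟙 (does (y ≟ᴬ w)) + 𝟙 (does (y ∈? W)))
    ≡⟨ sumMap-+ xs (λ y → 𝟙 (does (y ≟ᴬ w))) (λ y → 𝟙 (does (y ∈? W))) ⟩
      sumMap xs (λ y → 𝟙 (does (y ≟ᴬ w))) + sumMap xs (λ y → 𝟙 (does (y ∈? W)))
    ≤⟨ +-mono-≤ (sumMap-𝟙-≟-unique xs w u) (sumMap-𝟙-∈-unique xs W u) ⟩
      suc (length W) ∎
    where open ≤-Reasoning

module _ {n : ℕ} where
  open import Data.List.Membership.DecPropositional (_≟_ {n}) using (_∈?_)

  countFin>length⇒∃∉ : ∀ (p : Fin n → Bool) (W : List (Fin n)) → length W < countFin n p →
    ∃ λ y → p y ≡ true × y ∉ W
  countFin>length⇒∃∉ p W |W|<count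
    with sumMap-𝟙-pos⇒∃ (allFin n) (λ y → p y ∧ not (does (y ∈? W))) fresh-pos
    where
    inW fresh : Fin n → Bool
    inW y = does (y ∈? W)
    fresh y = p y ∧ not (inW y)
    fresh-pos : 0 < sumMap (allFin n) (𝟙 ∘ fresh)
    fresh-pos = +-cancelˡ-< (length W) 0 _ (begin-strict
        length W + 0
      ≡⟨ +-identityʳ (length W) ⟩
        length W
      <⟨ |W|<count ⟩
        countFin n p
      ≤⟨ sumMap-mono (allFin n) (λ y → 𝟙-≤-∧-not (p y) (inW y)) ⟩
        sumMap (allFin n) (λ y → 𝟙 (inW y) + 𝟙 (fresh y))
      ≡⟨ sumMap-+ (allFin n) (𝟙 ∘ inW) (𝟙 ∘ fresh) ⟩
        sumMap (allFin n) (𝟙 ∘ inW) + sumMap (allFin n) (𝟙 ∘ fresh)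
      ≤⟨ +-monoˡ-≤ _ (sumMap-𝟙-∈-unique _≟_ (allFin n) W (allFin⁺ n)) ⟩
        length W + sumMap (allFin n) (𝟙 ∘ fresh) ∎)
      where open ≤-Reasoning
  ... | y , fresh-y with p y in py | y ∈? W
  ... | true | no y∉W = y , py , y∉W

  module _ (H : 3Graph n) where

    ordered-pair≤edge : ∀ v b c →
      𝟙 (⌊ toℕ b <? toℕ c ⌋ ∧ edge H v b c) + 𝟙 (⌊ toℕ c <? toℕ b ⌋ ∧ edge H v c b)
        ≤ 𝟙 (edge H v b c)
    ordered-pair≤edge v b c with toℕ b <? toℕ c | toℕ c <? toℕ b
    ... | yes b<c | yes c<b = contradiction c<b (<-asym b<c)
    ... | yes _   | no  _   = ≤-reflexive (+-identityʳ _)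
    ... | no  _   | yes _   = ≤-reflexive (cong 𝟙 (sym₂₃ H v c b))
    ... | no  _   | no  _   = z≤n

    -- deg H v counts each edge {v , b , c} once, as the pair with b < c, so 2 · deg H v counts
    -- ordered pairs (b , c) of neighbours, all of which lie in W.
    2*deg≤length² : ∀ v (W : List (Fin n)) → (∀ b c → edge H v b c ≡ true → b ∈ W) →
      2 * deg H v ≤ length W * length W
    2*deg≤length² v W nbr⊆W = begin
        deg H v + (deg H v + 0)
      ≡⟨ cong (deg H v +_) (+-identityʳ (deg H v)) ⟩
        D + D
      ≡⟨ cong (D +_) (sumMap-comm Vs Vs ordered) ⟩
        D + sumMap Vs (λ b → sumMap Vs (λ c → ordered c b))
      ≡⟨ sym (sumMap-+ Vs (λ b → sumMap Vs (ordered b)) (λ b → sumMap Vs (λ c → ordered c b))) ⟩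
        sumMap Vs (λ b → sumMap Vs (ordered b) + sumMap Vs (λ c → ordered c b))
      ≡⟨ sumMap-cong Vs (λ b → sym (sumMap-+ Vs (ordered b) (λ c → ordered c b))) ⟩
        sumMap Vs (λ b → sumMap Vs (λ c → ordered b c + ordered c b))
      ≤⟨ sumMap-mono Vs (λ b → sumMap-mono Vs (λ c →
           ≤-trans (ordered-pair≤edge v b c) (edge≤inW b c))) ⟩
        sumMap Vs (λ b → sumMap Vs (λ c → inW b * inW c))
      ≡⟨ sumMap-cong Vs (λ b → sumMap-*ˡ Vs (inW b) inW) ⟩
        sumMap Vs (λ b → inW b * sumMap Vs inW)
      ≡⟨ sumMap-*ʳ Vs (sumMap Vs inW) inW ⟩
        sumMap Vs inW * sumMap Vs inW
      ≤⟨ *-mono-≤ inW≤W inW≤W ⟩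
        length W * length W ∎
      where
      open ≤-Reasoning
      Vs : List (Fin n)
      Vs = allFin n
      ordered : Fin n → Fin n → ℕ
      ordered b c = 𝟙 (⌊ toℕ b <? toℕ c ⌋ ∧ edge H v b c)
      D : ℕ
      D = sumMap Vs (λ b → sumMap Vs (ordered b))
      inW : Fin n → ℕ
      inW b = 𝟙 (does (b ∈? W))
      inW≤W : sumMap Vs inW ≤ length W
      inW≤W = sumMap-𝟙-∈-unique _≟_ Vs W (allFin⁺ n)
      edge≤inW : ∀ b c → 𝟙 (edge H v b c) ≤ inW b * inW c
      edge≤inW b c with edge H v b c in e
      ... | false = z≤n
      ... | true rewrite dec-true (b ∈? W) (nbr⊆W b c e)
                       | dec-true (c ∈? W) (nbr⊆W c b (trans (sym₂₃ H v c b) e)) = ≤-refl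

twiceG-lower : ∀ n t → 3 * t ^ 3 + 12 ∸ 9 * t ≤ twiceG n t
twiceG-lower n t with t % 2
... | 1           = m≤n+m _ ((t ∸ 1) * n)
... | 0           = ≤-trans (∸-monoʳ-≤ (3 * t ^ 3 + 12) (*-monoˡ-≤ t (m≤m+n 5 4))) (m≤n+m _ ((t ∸ 2) * n))
... | suc (suc _) = ≤-trans (∸-monoʳ-≤ (3 * t ^ 3 + 12) (*-monoˡ-≤ t (m≤m+n 5 4))) (m≤n+m _ ((t ∸ 2) * n))

[2t+2]²<twiceG : ∀ n t → 3 ≤ t → 2 * (t + 1) * (2 * (t + 1)) < twiceG n t
[2t+2]²<twiceG n .(3 + s) (s≤s (s≤s (s≤s {n = s} z≤n))) = ≤-trans (begin
    suc X                           ≤⟨ m≤m+n (suc X) excess ⟩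
    suc X + excess                  ≡⟨ sym (m+n∸n≡m (suc X + excess) (9 * t)) ⟩
    suc X + excess + 9 * t ∸ 9 * t  ≡⟨ cong (_∸ 9 * t) (identity s) ⟩
    3 * t ^ 3 + 12 ∸ 9 * t          ∎) (twiceG-lower n t)
  where
  open ≤-Reasoning
  t X excess : ℕ
  t = 3 + s
  X = 2 * (t + 1) * (2 * (t + 1))
  excess = 1 + 40 * s + 23 * (s * s) + 3 * (s * s * s)
  identity : ∀ s →
    suc (2 * (3 + s + 1) * (2 * (3 + s + 1))) + (1 + 40 * s + 23 * (s * s) + 3 * (s * s * s)) + 9 * (3 + s)
      ≡ 3 * ((3 + s) * ((3 + s) * ((3 + s) * 1))) + 12
  identity = solve-∀

length-++-∷ : ∀ {A : Set} (xs : List A) x ys → length (xs ++ x ∷ ys) ≡ suc (length (ys ++ xs))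
length-++-∷ xs x ys = begin
  length (xs ++ x ∷ ys)        ≡⟨ length-++ xs ⟩
  length xs + suc (length ys)  ≡⟨ +-suc (length xs) (length ys) ⟩
  suc (length xs + length ys)  ≡⟨ cong suc (+-comm (length xs) (length ys)) ⟩
  suc (length ys + length xs)  ≡⟨ cong suc (sym (length-++ ys)) ⟩
  suc (length (ys ++ xs))      ∎
  where open ≡-Reasoning

Unique-resp-↭ : ∀ {A : Set} {xs ys : List A} → xs ↭ ys → Unique xs → Unique ys
Unique-resp-↭ {A} p = PermutationSetoid.Unique-resp-↭ (setoid A) (↭⇒↭ₛ p)

module _ {n : ℕ} (H : 3Graph n) where
  private V = Fin n
  open import Data.List.Membership.DecPropositional (_≟_ {n}) using (_∈?_)
  open import Algebra.Solver.CommutativeMonoid (++-commutativeMonoid {A = V}) using (solve; _⊕_; _⊜_)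

  edge-swap₁₂ : ∀ {a b c} → edge H a b c ≡ true → edge H b a c ≡ true
  edge-swap₁₂ {a} {b} {c} = trans (sym₁₂ H b a c)

  edge-swap₂₃ : ∀ {a b c} → edge H a b c ≡ true → edge H a c b ≡ true
  edge-swap₂₃ {a} {b} {c} = trans (sym₂₃ H a c b)

  edge-rotate : ∀ {a b c} → edge H a b c ≡ true → edge H b c a ≡ true
  edge-rotate = edge-swap₂₃ ∘ edge-swap₁₂

  edge-reverse : ∀ {a b c} → edge H a b c ≡ true → edge H c b a ≡ true
  edge-reverse = edge-swap₁₂ ∘ edge-swap₂₃ ∘ edge-swap₁₂

  LinearPath : ℕ → Set
  LinearPath m = Σ (ℕ → V) (IsLinearPath H m)

  -- The links (a₀ , b₀) ∷ … ∷ (aₘ₋₁ , bₘ₋₁) with end aₘ stand for the walk a₀ b₀ a₁ … bₘ₋₁ aₘ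
  -- with edges {aᵢ , bᵢ , aᵢ₊₁}; for a cycle, aₘ = a₀.
  first : List (V × V) → V → V
  first []            e = e
  first ((a , _) ∷ _) _ = a

  Walk : List (V × V) → V → Set
  Walk []             e = ⊤
  Walk ((a , b) ∷ ls) e = edge H a b (first ls e) ≡ true × Walk ls e

  Cycle : List (V × V) → V → Set
  Cycle ls e = Walk ls e × e ≡ first ls e

  vertices : List (V × V) → List V
  vertices []             = []
  vertices ((a , b) ∷ ls) = a ∷ b ∷ vertices ls

  vertices-++ : ∀ ls ks → vertices (ls ++ ks) ≡ vertices ls ++ vertices ks
  vertices-++ []             ks = refl
  vertices-++ ((a , b) ∷ ls) ks = cong (λ vs → a ∷ b ∷ vs) (vertices-++ ls ks)

  length-vertices : ∀ ls → length (vertices ls) ≡ 2 * length ls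
  length-vertices []       = refl
  length-vertices (_ ∷ ls) =
    cong suc (trans (cong suc (length-vertices ls)) (sym (+-suc (length ls) (length ls + 0))))

  first-++ : ∀ ls ks e → first (ls ++ ks) e ≡ first ls (first ks e)
  first-++ []      ks e = refl
  first-++ (_ ∷ _) ks e = refl

  Walk-++⁻ : ∀ ls ks e → Walk (ls ++ ks) e → Walk ls (first ks e) × Walk ks e
  Walk-++⁻ []             ks e w         = tt , w
  Walk-++⁻ ((a , b) ∷ ls) ks e (abc , w) with Walk-++⁻ ls ks e w
  ... | wls , wks = (subst (λ c → edge H a b c ≡ true) (first-++ ls ks e) abc , wls) , wks

  Walk-++⁺ : ∀ ls ks e → Walk ls (first ks e) → Walk ks e → Walk (ls ++ ks) e
  Walk-++⁺ []             ks e _           wks = wks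
  Walk-++⁺ ((a , b) ∷ ls) ks e (abc , wls) wks =
    subst (λ c → edge H a b c ≡ true) (sym (first-++ ls ks e)) abc , Walk-++⁺ ls ks e wls wks

  Cycle-rotate : ∀ ls ks e → Cycle (ls ++ ks) e → Cycle (ks ++ ls) (first ks e)
  Cycle-rotate ls ks e (w , closed) =
    Walk-++⁺ ks ls (first ks e) (subst (Walk ks) e≡ (proj₂ halves)) (proj₁ halves) ,
    trans (cong (first ks) e≡) (sym (first-++ ks ls (first ks e)))
    where
    halves : Walk ls (first ks e) × Walk ks e
    halves = Walk-++⁻ ls ks e w
    e≡ : e ≡ first ls (first ks e)
    e≡ = trans closed (first-++ ls ks e)

  nthOr : List V → V → ℕ → V
  nthOr []       d _       = d
  nthOr (v ∷ vs) d zero    = v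
  nthOr (v ∷ vs) d (suc i) = nthOr vs d i

  nthOr-∈ : ∀ vs d i → i < length vs → nthOr vs d i ∈ vs
  nthOr-∈ (v ∷ vs) d zero    _        = here refl
  nthOr-∈ (v ∷ vs) d (suc i) (s≤s i<) = there (nthOr-∈ vs d i i<)

  nthOr-injective : ∀ vs d i j → Unique vs → i < length vs → j < length vs →
    nthOr vs d i ≡ nthOr vs d j → i ≡ j
  nthOr-injective (v ∷ vs) d zero    zero    _        _        _        _  = refl
  nthOr-injective (v ∷ vs) d zero    (suc j) (v∉ ∷ _) _        (s≤s j<) eq =
    contradiction eq (All.lookup v∉ (nthOr-∈ vs d j j<))
  nthOr-injective (v ∷ vs) d (suc i) zero    (v∉ ∷ _) (s≤s i<) _        eq =
    contradiction (sym eq) (All.lookup v∉ (nthOr-∈ vs d i i<))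
  nthOr-injective (v ∷ vs) d (suc i) (suc j) (_ ∷ u)  (s≤s i<) (s≤s j<) eq =
    cong suc (nthOr-injective vs d i j u i< j< eq)

  nthOr-first : ∀ ls e d → nthOr (vertices ls ∷ʳ e) d 0 ≡ first ls e
  nthOr-first []      e d = refl
  nthOr-first (_ ∷ _) e d = refl

  nthOr-edge : ∀ ls e i → Walk ls e → i < length ls →
    let z = nthOr (vertices ls ∷ʳ e) e in edge H (z (2 * i)) (z (2 * i + 1)) (z (2 * i + 2)) ≡ true
  nthOr-edge ((a , b) ∷ ls) e zero    (abc , _) _        rewrite nthOr-first ls e e = abc
  nthOr-edge ((a , b) ∷ ls) e (suc i) (_ , w)   (s≤s i<) rewrite +-suc i (i + 0)    = nthOr-edge ls e i w i<

  Walk⇒LinearPath : ∀ ls e → Walk ls e → Unique (vertices ls ∷ʳ e) → LinearPath (length ls)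
  Walk⇒LinearPath ls e w u = nthOr vs e , injective , (λ i → nthOr-edge ls e i w)
    where
    vs : List V
    vs = vertices ls ∷ʳ e
    |vs| : length vs ≡ suc (2 * length ls)
    |vs| = trans (length-++ (vertices ls)) (trans (+-comm _ 1) (cong suc (length-vertices ls)))
    injective : ∀ i j → i ≤ 2 * length ls → j ≤ 2 * length ls → nthOr vs e i ≡ nthOr vs e j → i ≡ j
    injective i j i≤ j≤ =
      nthOr-injective vs e i j u (subst (i <_) (sym |vs|) (s≤s i≤)) (subst (j <_) (sym |vs|) (s≤s j≤))

  ∉⇒Unique-∷ : ∀ {v} {vs : List V} → v ∉ vs → Unique vs → Unique (v ∷ vs)
  ∉⇒Unique-∷ v∉ u = ¬Any⇒All¬ _ v∉ ∷ u

  ∈-vertices⇒split : ∀ ls a → a ∈ vertices ls →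
    ∃ λ ks → ∃ λ c → ∃ λ d → ∃ λ js → ls ≡ ks ++ (c , d) ∷ js × (a ≡ c ⊎ a ≡ d)
  ∈-vertices⇒split ((c , d) ∷ ls) a (here a≡c)         = [] , c , d , ls , refl , inj₁ a≡c
  ∈-vertices⇒split ((c , d) ∷ ls) a (there (here a≡d)) = [] , c , d , ls , refl , inj₂ a≡d
  ∈-vertices⇒split ((c , d) ∷ ls) a (there (there a∈)) with ∈-vertices⇒split ls a a∈
  ... | ks , c′ , d′ , js , refl , a≡ = (c , d) ∷ ks , c′ , d′ , js , refl , a≡

  private
    Walk-∷ʳ-open : ∀ c d T → Walk ((c , d) ∷ T) c → InitLast T → 1 ≤ length T →
      ∃ λ ks → ∃ λ g → ∃ λ h → Walk ((c , d) ∷ ks) g × T ≡ ks ∷ʳ (g , h)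
    Walk-∷ʳ-open c d .(ks ∷ʳ (g , h)) (cd- , w) (ks ∷ʳ′ (g , h)) _ =
      ks , g , h , (subst (λ f → edge H c d f ≡ true) (first-++ ks [ (g , h) ] c) cd- ,
                    proj₁ (Walk-++⁻ ks [ (g , h) ] c w)) , refl

    orient : ∀ {c d a ks g} → Walk ((c , d) ∷ ks) g → (a ≡ c ⊎ a ≡ d) →
      ∃ λ a′ → Walk ((a , a′) ∷ ks) g × (∀ vs → c ∷ d ∷ vs ↭ a ∷ a′ ∷ vs)
    orient w                 (inj₁ refl) = _ , w , λ _ → ↭-refl
    orient {c} {d} (cd- , w) (inj₂ refl) = c , (edge-swap₁₂ cd- , w) , λ _ → ↭-swap c d ↭-refl

  -- Rotate the link of a to the front and delete the last vertex h: what is left is a walk from a.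
  Cycle-open-at : ∀ ls s a → Cycle ls s → 2 ≤ length ls → a ∈ vertices ls →
    ∃ λ a′ → ∃ λ ks → ∃ λ g → ∃ λ h → Walk ((a , a′) ∷ ks) g ×
      vertices ls ↭ h ∷ vertices ((a , a′) ∷ ks) ∷ʳ g × length ls ≡ 2 + length ks
  Cycle-open-at ls s a cyc 2≤ a∈ with ∈-vertices⇒split ls a a∈
  ... | A , c , d , B , refl , a≡
      with Walk-∷ʳ-open c d (B ++ A) (proj₁ (Cycle-rotate A ((c , d) ∷ B) s cyc)) (initLast (B ++ A))
             (≤-pred (subst (2 ≤_) (length-++-∷ A (c , d) B) 2≤))
  ... | ks , g , h , w , BA≡ with orient w a≡
  ... | a′ , w′ , cd↭aa′ = a′ , ks , g , h , w′ , perm , len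
    where
    len : length (A ++ (c , d) ∷ B) ≡ 2 + length ks
    len = begin
      length (A ++ (c , d) ∷ B)  ≡⟨ length-++-∷ A (c , d) B ⟩
      suc (length (B ++ A))      ≡⟨ cong (suc ∘ length) BA≡ ⟩
      suc (length (ks ∷ʳ _))     ≡⟨ cong suc (trans (length-++ ks) (+-comm (length ks) 1)) ⟩
      2 + length ks              ∎
      where open ≡-Reasoning
    perm : vertices (A ++ (c , d) ∷ B) ↭ h ∷ a ∷ a′ ∷ vertices ks ∷ʳ g
    perm = begin
        vertices (A ++ (c , d) ∷ B)
      ≡⟨ vertices-++ A ((c , d) ∷ B) ⟩
        vertices A ++ c ∷ d ∷ vertices B
      ↭⟨ solve 4 (λ VA C D VB → VA ⊕ (C ⊕ (D ⊕ VB)) ⊜ C ⊕ (D ⊕ (VB ⊕ VA))) ↭-refl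
           (vertices A) [ c ] [ d ] (vertices B) ⟩
        c ∷ d ∷ vertices B ++ vertices A
      ≡⟨ cong (λ vs → c ∷ d ∷ vs) (trans (sym (vertices-++ B A)) (trans (cong vertices BA≡) (vertices-++ ks _))) ⟩
        c ∷ d ∷ vertices ks ++ g ∷ h ∷ []
      ↭⟨ cd↭aa′ _ ⟩
        a ∷ a′ ∷ vertices ks ++ g ∷ h ∷ []
      ↭⟨ solve 5 (λ A A′ K G H → A ⊕ (A′ ⊕ (K ⊕ (G ⊕ H))) ⊜ H ⊕ (A ⊕ (A′ ⊕ (K ⊕ G)))) ↭-refl
           [ a ] [ a′ ] (vertices ks) [ g ] [ h ] ⟩
        h ∷ a ∷ a′ ∷ vertices ks ∷ʳ g
      ∎
      where open PermutationReasoning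

  Cycle+pendant⇒LinearPath : ∀ ls s a p q → Cycle ls s → 2 ≤ length ls → Unique (vertices ls) →
    a ∈ vertices ls → p ∉ vertices ls → q ∉ vertices ls → p ≢ q → edge H p q a ≡ true →
    LinearPath (length ls)
  Cycle+pendant⇒LinearPath ls s a p q cyc 2≤ u a∈ p∉ q∉ p≢q pqa
    with Cycle-open-at ls s a cyc 2≤ a∈
  ... | a′ , ks , g , h , w , perm , len =
    subst LinearPath (sym len)
      (Walk⇒LinearPath ((p , q) ∷ (a , a′) ∷ ks) g (pqa , w)
        (∉⇒Unique-∷ (λ { (here p≡q) → p≢q p≡q ; (there p∈) → off p∉ p∈ })
          (∉⇒Unique-∷ (off q∉) (AllPairs.tail (Unique-resp-↭ perm u)))))
    where
    off : ∀ {v} → v ∉ vertices ls → v ∉ vertices ((a , a′) ∷ ks) ∷ʳ g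
    off v∉ v∈ = v∉ (∈-resp-↭ (↭-sym perm) (there v∈))

  Cycle-swap : ∀ A B u y₁ y₂ s → Cycle (A ++ (u , y₁) ∷ B) s → edge H u y₂ (first B s) ≡ true →
    Cycle (A ++ (u , y₂) ∷ B) s
  Cycle-swap A B u y₁ y₂ s (w , closed) uy₂B =
    Walk-++⁺ A ((u , y₂) ∷ B) s (proj₁ halves) (uy₂B , proj₂ (proj₂ halves)) ,
    trans closed (trans (first-++ A ((u , y₁) ∷ B) s) (sym (first-++ A ((u , y₂) ∷ B) s)))
    where
    halves : Walk A u × Walk ((u , y₁) ∷ B) s
    halves = Walk-++⁻ A ((u , y₁) ∷ B) s w

  vertices-swap : ∀ A B u y₁ y₂ →
    y₂ ∷ vertices (A ++ (u , y₁) ∷ B) ↭ y₁ ∷ vertices (A ++ (u , y₂) ∷ B)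
  vertices-swap A B u y₁ y₂ = begin
      y₂ ∷ vertices (A ++ (u , y₁) ∷ B)
    ≡⟨ cong (y₂ ∷_) (vertices-++ A ((u , y₁) ∷ B)) ⟩
      y₂ ∷ vertices A ++ u ∷ y₁ ∷ vertices B
    ↭⟨ solve 5 (λ Y₂ VA U Y₁ VB → Y₂ ⊕ (VA ⊕ (U ⊕ (Y₁ ⊕ VB))) ⊜ Y₁ ⊕ (VA ⊕ (U ⊕ (Y₂ ⊕ VB)))) ↭-refl
         [ y₂ ] (vertices A) [ u ] [ y₁ ] (vertices B) ⟩
      y₁ ∷ vertices A ++ u ∷ y₂ ∷ vertices B
    ≡⟨ cong (y₁ ∷_) (sym (vertices-++ A ((u , y₂) ∷ B))) ⟩
      y₁ ∷ vertices (A ++ (u , y₂) ∷ B)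
    ∎
    where open PermutationReasoning

  swapped-neighbours⊆cycle : ∀ A B u y₁ y₂ s → let C = A ++ (u , y₁) ∷ B in
    Cycle C s → edge H u y₂ (first B s) ≡ true → Unique (y₂ ∷ vertices C) → 2 ≤ length C →
    ¬ LinearPath (length C) → ∀ b c → edge H y₂ b c ≡ true → b ∈ vertices C
  swapped-neighbours⊆cycle A B u y₁ y₂ s cyc uy₂B (y₂∉ ∷ u₁) 2≤ noPath b c y₂bc
    with distinct H y₂ b c y₂bc | b ∈? vertices (A ++ (u , y₁) ∷ B) | c ∈? vertices (A ++ (u , y₁) ∷ B)
  ... | _                 | yes b∈ | _      = b∈
  ... | y₂≢b , _          | no  b∉ | yes c∈ =
    contradiction
      (Cycle+pendant⇒LinearPath _ s c b y₂ cyc 2≤ u₁ c∈ b∉ (All¬⇒¬Any y₂∉) (y₂≢b ∘ sym)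
        (edge-swap₁₂ y₂bc))
      noPath
  ... | y₂≢b , b≢c , y₂≢c | no  b∉ | no  c∉ =
    contradiction
      (subst LinearPath same-length
        (Cycle+pendant⇒LinearPath _ s y₂ b c (Cycle-swap A B u y₁ y₂ s cyc uy₂B)
          (subst (2 ≤_) (sym same-length) 2≤)
          (AllPairs.tail (Unique-resp-↭ (vertices-swap A B u y₁ y₂) (y₂∉ ∷ u₁)))
          y₂∈ (off b∉ y₂≢b) (off c∉ y₂≢c) b≢c (edge-swap₂₃ (edge-swap₁₂ y₂bc))))
      noPath
    where
    same-length : length (A ++ (u , y₂) ∷ B) ≡ length (A ++ (u , y₁) ∷ B)
    same-length = trans (length-++ A) (sym (length-++ A))
    y₂∈ : y₂ ∈ vertices (A ++ (u , y₂) ∷ B)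
    y₂∈ = subst (y₂ ∈_) (sym (vertices-++ A ((u , y₂) ∷ B))) (∈-++⁺ʳ (vertices A) (there (here refl)))
    off : ∀ {v} → v ∉ vertices (A ++ (u , y₁) ∷ B) → y₂ ≢ v → v ∉ vertices (A ++ (u , y₂) ∷ B)
    off v∉ y₂≢v v∈ with ∈-resp-↭ (↭-sym (vertices-swap A B u y₁ y₂)) (there v∈)
    ... | here v≡y₂ = y₂≢v (sym v≡y₂)
    ... | there v∈₁ = v∉ v∈₁

swapped-vertex-contradiction : ∀ {n} (H : 3Graph n) t → 3 ≤ t → (∀ v → twiceG n t ≤ 2 * deg H v) →
  ¬ LinearPath H (t + 1) → ∀ A B u y₁ y₂ s → let C = A ++ (u , y₁) ∷ B in
  Cycle H C s → edge H u y₂ (first H B s) ≡ true → Unique (y₂ ∷ vertices H C) → length C ≡ t + 1 → ⊥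
swapped-vertex-contradiction {n} H t 3≤t δ noPath A B u y₁ y₂ s cyc uy₂B u₂ len =
  <-irrefl refl (begin-strict
    twiceG n t                                     ≤⟨ δ y₂ ⟩
    2 * deg H y₂                                   ≤⟨ 2*deg≤length² H y₂ (vertices H C) neighbours⊆C ⟩
    length (vertices H C) * length (vertices H C)  ≡⟨ cong (λ m → m * m) |C| ⟩
    2 * (t + 1) * (2 * (t + 1))                    <⟨ [2t+2]²<twiceG n t 3≤t ⟩
    twiceG n t                                     ∎)
  where
  open ≤-Reasoning
  C : List (Fin n × Fin n)
  C = A ++ (u , y₁) ∷ B
  |C| : length (vertices H C) ≡ 2 * (t + 1)
  |C| = trans (length-vertices H C) (cong (2 *_) len)
  neighbours⊆C : ∀ b c → edge H y₂ b c ≡ true → b ∈ vertices H C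
  neighbours⊆C = swapped-neighbours⊆cycle H A B u y₁ y₂ s cyc uy₂B u₂
    (subst (2 ≤_) (sym len) (≤-trans (s≤s (s≤s z≤n)) (≤-trans 3≤t (m≤m+n t 1))))
    (subst (λ m → ¬ LinearPath H m) (sym len) noPath)

module OnPath {n : ℕ} (H : 3Graph n) (t : ℕ) (x : ℕ → Fin n) (P : IsLinearPath H t x) where
  open import Algebra.Solver.CommutativeMonoid (++-commutativeMonoid {A = Fin n}) using (solve; _⊕_; _⊜_)

  private
    x-injective : ∀ i j → i ≤ 2 * t → j ≤ 2 * t → x i ≡ x j → i ≡ j
    x-injective = proj₁ P

    x-edge : ∀ i → i < t → edge H (x (2 * i)) (x (2 * i + 1)) (x (2 * i + 2)) ≡ true
    x-edge = proj₂ P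

    2[1+a]≡2a+2 : ∀ a → 2 * suc a ≡ 2 * a + 2
    2[1+a]≡2a+2 = solve-∀

    2[1+a]≡2+2a : ∀ a → 2 * suc a ≡ 2 + 2 * a
    2[1+a]≡2+2a = solve-∀

  forward : ℕ → ℕ → List (Fin n × Fin n)
  forward a zero    = []
  forward a (suc l) = (x (2 * a) , x (2 * a + 1)) ∷ forward (suc a) l

  backward : ℕ → ℕ → List (Fin n × Fin n)
  backward a zero    = []
  backward a (suc l) = (x (2 * (a + suc l)) , x (2 * (a + l) + 1)) ∷ backward a l

  length-forward : ∀ a l → length (forward a l) ≡ l
  length-forward a zero    = refl
  length-forward a (suc l) = cong suc (length-forward (suc a) l)

  length-backward : ∀ a l → length (backward a l) ≡ l
  length-backward a zero    = refl
  length-backward a (suc l) = cong suc (length-backward a l)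

  first-forward : ∀ a l → first H (forward a l) (x (2 * (a + l))) ≡ x (2 * a)
  first-forward a zero    = cong (λ i → x (2 * i)) (+-identityʳ a)
  first-forward a (suc l) = refl

  first-backward : ∀ a l → first H (backward a l) (x (2 * a)) ≡ x (2 * (a + l))
  first-backward a zero    = cong (λ i → x (2 * i)) (sym (+-identityʳ a))
  first-backward a (suc l) = refl

  Walk-forward : ∀ a l → a + l ≤ t → Walk H (forward a l) (x (2 * (a + l)))
  Walk-forward a zero    _     = _
  Walk-forward a (suc l) a+l≤t rewrite +-suc a l =
    subst (λ v → edge H (x (2 * a)) (x (2 * a + 1)) v ≡ true)
      (trans (cong x (sym (2[1+a]≡2a+2 a))) (sym (first-forward (suc a) l)))
      (x-edge a (≤-trans (s≤s (m≤m+n a l)) a+l≤t)) ,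
    Walk-forward (suc a) l a+l≤t

  Walk-backward : ∀ a l → a + l ≤ t → Walk H (backward a l) (x (2 * a))
  Walk-backward a zero    _     = _
  Walk-backward a (suc l) a+l≤t =
    subst₂ (λ u v → edge H (x u) (x (2 * (a + l) + 1)) v ≡ true)
      (trans (sym (2[1+a]≡2a+2 (a + l))) (cong (2 *_) (sym (+-suc a l)))) (sym (first-backward a l))
      (edge-reverse H (x-edge (a + l) (subst (_≤ t) (+-suc a l) a+l≤t))) ,
    Walk-backward a l (≤-trans (+-monoʳ-≤ a (n≤1+n l)) a+l≤t)

  forward-++ : ∀ a l₁ l₂ → forward a (l₁ + l₂) ≡ forward a l₁ ++ forward (a + l₁) l₂
  forward-++ a zero     l₂ = cong (λ i → forward i l₂) (sym (+-identityʳ a))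
  forward-++ a (suc l₁) l₂ = cong (_ ∷_) (trans (forward-++ (suc a) l₁ l₂)
    (cong (λ i → forward (suc a) l₁ ++ forward i l₂) (sym (+-suc a l₁))))

  forward-∷ʳ : ∀ a l → forward a (suc l) ≡ forward a l ∷ʳ (x (2 * (a + l)) , x (2 * (a + l) + 1))
  forward-∷ʳ a zero    = cong (λ i → [ (x (2 * i) , x (2 * i + 1)) ]) (sym (+-identityʳ a))
  forward-∷ʳ a (suc l) rewrite +-suc a l = cong (_ ∷_) (forward-∷ʳ (suc a) l)

  x[2a]∷backward↭forward∷ʳ : ∀ a l →
    x (2 * a) ∷ vertices H (backward a l) ↭ vertices H (forward a l) ∷ʳ x (2 * (a + l))
  x[2a]∷backward↭forward∷ʳ a zero    = ↭-reflexive (cong (λ i → [ x (2 * i) ]) (sym (+-identityʳ a)))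
  x[2a]∷backward↭forward∷ʳ a (suc l) = begin
      x₀ ∷ c ∷ b ∷ vertices H (backward a l)
    ↭⟨ solve 4 (λ X₀ C B V → X₀ ⊕ (C ⊕ (B ⊕ V)) ⊜ C ⊕ (B ⊕ (X₀ ⊕ V))) ↭-refl
         [ x₀ ] [ c ] [ b ] (vertices H (backward a l)) ⟩
      c ∷ b ∷ x₀ ∷ vertices H (backward a l)
    ↭⟨ ↭-prep c (↭-prep b (x[2a]∷backward↭forward∷ʳ a l)) ⟩
      c ∷ b ∷ vertices H (forward a l) ∷ʳ d
    ↭⟨ solve 4 (λ C B V D → C ⊕ (B ⊕ (V ⊕ D)) ⊜ (V ⊕ (D ⊕ B)) ⊕ C) ↭-refl
         [ c ] [ b ] (vertices H (forward a l)) [ d ] ⟩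
      (vertices H (forward a l) ++ d ∷ b ∷ []) ∷ʳ c
    ≡⟨ cong (_∷ʳ c) (sym (trans (cong (vertices H) (forward-∷ʳ a l)) (vertices-++ H (forward a l) _))) ⟩
      vertices H (forward a (suc l)) ∷ʳ c
    ∎
    where
    open PermutationReasoning
    x₀ c b d : Fin n
    x₀ = x (2 * a)
    c = x (2 * (a + suc l))
    b = x (2 * (a + l) + 1)
    d = x (2 * (a + l))

  block : ℕ → ℕ → List (Fin n)
  block a zero    = []
  block a (suc l) = x a ∷ block (suc a) l

  ∈-block⁻ : ∀ {v} a l → v ∈ block a l → ∃ λ i → a ≤ i × i < a + l × v ≡ x i
  ∈-block⁻ a (suc l) (here v≡)  = a , ≤-refl , subst (a <_) (sym (+-suc a l)) (s≤s (m≤m+n a l)) , v≡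
  ∈-block⁻ a (suc l) (there v∈) with ∈-block⁻ (suc a) l v∈
  ... | i , a<i , i< , v≡ = i , <⇒≤ a<i , subst (i <_) (sym (+-suc a l)) i< , v≡

  Unique-block : ∀ a l → a + l ≤ suc (2 * t) → Unique (block a l)
  Unique-block a zero    _ = []
  Unique-block a (suc l) a+l≤ rewrite +-suc a l =
    ∉⇒Unique-∷ H xa∉ (Unique-block (suc a) l a+l≤)
    where
    xa∉ : x a ∉ block (suc a) l
    xa∉ xa∈ with ∈-block⁻ (suc a) l xa∈
    ... | i , a<i , i< , xa≡xi =
      <⇒≢ a<i (x-injective a i (≤-pred (≤-trans (s≤s (m≤m+n a l)) a+l≤)) (≤-pred (≤-trans i< a+l≤)) xa≡xi)

  block-∷ʳ : ∀ a l → block a l ∷ʳ x (a + l) ≡ block a (suc l)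
  block-∷ʳ a zero    = cong [_] (cong x (+-identityʳ a))
  block-∷ʳ a (suc l) =
    cong (x a ∷_) (trans (cong (λ i → block (suc a) l ∷ʳ x i) (+-suc a l)) (block-∷ʳ (suc a) l))

  vertices-forward : ∀ a l → vertices H (forward a l) ≡ block (2 * a) (2 * l)
  vertices-forward a zero    = refl
  vertices-forward a (suc l) = begin
      x (2 * a) ∷ x (2 * a + 1) ∷ vertices H (forward (suc a) l)
    ≡⟨ cong (λ vs → x (2 * a) ∷ x (2 * a + 1) ∷ vs) (vertices-forward (suc a) l) ⟩
      x (2 * a) ∷ x (2 * a + 1) ∷ block (2 * suc a) (2 * l)
    ≡⟨ cong₂ (λ i j → x (2 * a) ∷ x i ∷ block j (2 * l)) (+-comm (2 * a) 1) (2[1+a]≡2+2a a) ⟩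
      block (2 * a) (2 + 2 * l)
    ≡⟨ cong (block (2 * a)) (sym (2[1+a]≡2+2a l)) ⟩
      block (2 * a) (2 * suc l)
    ∎
    where open ≡-Reasoning

  pathVertices : List (Fin n)
  pathVertices = block 0 (suc (2 * t))

  forward∷ʳ≡pathVertices : vertices H (forward 0 t) ∷ʳ x (2 * t) ≡ pathVertices
  forward∷ʳ≡pathVertices = trans (cong (_∷ʳ x (2 * t)) (vertices-forward 0 t)) (block-∷ʳ 0 (2 * t))

  Outside : Fin n → Set
  Outside y = ∀ i → i ≤ 2 * t → x i ≢ y

  Outside⇒∉ : ∀ {y} → Outside y → y ∉ pathVertices
  Outside⇒∉ out y∈ with ∈-block⁻ 0 (suc (2 * t)) y∈
  ... | i , _ , i≤ , y≡xi = out i (≤-pred i≤) (sym y≡xi)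

  inPath≡false⇒Outside : ∀ {y} → inPath t x y ≡ false → Outside y
  inPath≡false⇒Outside {y} y∉P i i≤ xi≡y =
    subst T y∉P (any⁺ _ (Any.map (λ { refl → fromWitness xi≡y }) (∈-upTo⁺ (s≤s i≤))))

  Unique-++-pathVertices : ∀ ys → All Outside ys → Unique ys → Unique (ys ++ pathVertices)
  Unique-++-pathVertices ys outs u = Unique-++⁺ u (Unique-block 0 (suc (2 * t)) ≤-refl)
    (λ (y∈ys , y∈P) → Outside⇒∉ (All.lookup outs y∈ys) y∈P)

  Unique-y∷z∷pathVertices : ∀ {y z} → y ≢ z → Outside y → Outside z → Unique (y ∷ z ∷ pathVertices)
  Unique-y∷z∷pathVertices y≢z out-y out-z =
    Unique-++-pathVertices (_ ∷ _ ∷ []) (out-y ∷ out-z ∷ []) ((y≢z ∷ []) ∷ [] ∷ [])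

  Joins : ℕ → ℕ → Fin n → Set
  Joins a b y = edge H (x a) (x b) y ≡ true × Outside y

  joins-avoiding : ∀ a b (W : List (Fin n)) → length W < dP H t x a b → ∃ λ y → Joins a b y × y ∉ W
  joins-avoiding a b W |W|<d
    with countFin>length⇒∃∉ (λ y → edge H (x a) (x b) y ∧ not (inPath t x y)) W |W|<d
  ... | y , joins , y∉W with edge H (x a) (x b) y in e | inPath t x y in y∉P
  ... | true | false = y , (e , inPath≡false⇒Outside y∉P) , y∉W

  dP≤1 : ∀ {a b} → (∀ y₁ y₂ → y₁ ≢ y₂ → Joins a b y₁ → Joins a b y₂ → ⊥) → dP H t x a b ≤ 1
  dP≤1 {a} {b} no-pair = ≮⇒≥ λ 1<d →
    let y₁ , j₁ , _   = joins-avoiding a b [] (<⇒≤ 1<d)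
        y₂ , j₂ , y₂∉ = joins-avoiding a b [ y₁ ] 1<d
    in no-pair y₁ y₂ (λ y₁≡y₂ → y₂∉ (here (sym y₁≡y₂))) j₁ j₂

  dP≤1-beside : ∀ {a b c d} → 0 < dP H t x c d →
    (∀ y z → y ≢ z → Joins a b y → Joins c d z → ⊥) → dP H t x a b ≤ 1
  dP≤1-beside {a} {b} {c} {d} 0<d′ no-pair = ≮⇒≥ λ 1<d →
    let z , jz , _  = joins-avoiding c d [] 0<d′
        y , jy , y∉ = joins-avoiding a b [ z ] 1<d
    in no-pair y z (λ y≡z → y∉ (here y≡z)) jy jz

  dP≤2-beside : ∀ {a b c d} → 0 < dP H t x c d →
    (∀ y₁ y₂ z → y₁ ≢ y₂ → y₁ ≢ z → y₂ ≢ z → Joins a b y₁ → Joins a b y₂ → Joins c d z → ⊥) →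
    dP H t x a b ≤ 2
  dP≤2-beside {a} {b} {c} {d} 0<d′ no-triple = ≮⇒≥ λ 2<d →
    let z  , jz , _   = joins-avoiding c d [] 0<d′
        y₁ , j₁ , y₁∉ = joins-avoiding a b [ z ] (<⇒≤ 2<d)
        y₂ , j₂ , y₂∉ = joins-avoiding a b (y₁ ∷ z ∷ []) 2<d
    in no-triple y₁ y₂ z (λ y₁≡y₂ → y₂∉ (here (sym y₁≡y₂))) (λ y₁≡z → y₁∉ (here y₁≡z))
         (λ y₂≡z → y₂∉ (there (here y₂≡z))) j₁ j₂ jz

  dP+dP≤2 : ∀ {a b c d} → (∀ {y z} → y ≢ z → Joins a b y → Joins c d z → ⊥) →
    0 < dP H t x a b → 0 < dP H t x c d → dP H t x a b + dP H t x c d ≤ 2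
  dP+dP≤2 no-pair 0<d₁ 0<d₂ =
    +-mono-≤ (dP≤1-beside 0<d₂ λ _ _ → no-pair)
             (dP≤1-beside 0<d₁ λ _ _ z≢y jz jy → no-pair (z≢y ∘ sym) jy jz)

  dP+dP≤4 : ∀ {a b c d} →
    (∀ y₁ y₂ z → y₁ ≢ y₂ → y₁ ≢ z → y₂ ≢ z → Joins a b y₁ → Joins a b y₂ → Joins c d z → ⊥) →
    (∀ z₁ z₂ y → z₁ ≢ z₂ → z₁ ≢ y → z₂ ≢ y → Joins c d z₁ → Joins c d z₂ → Joins a b y → ⊥) →
    0 < dP H t x a b → 0 < dP H t x c d → dP H t x a b + dP H t x c d ≤ 4
  dP+dP≤4 no-two-first no-two-second 0<d₁ 0<d₂ =
    +-mono-≤ (dP≤2-beside 0<d₂ no-two-first) (dP≤2-beside 0<d₁ no-two-second)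

  closing-cycle : Fin n → List (Fin n × Fin n)
  closing-cycle y = forward 0 t ++ [ (x (2 * t) , y) ]

  Cycle-closing : ∀ {y} → Joins 0 (2 * t) y → Cycle H (closing-cycle y) (x 0)
  Cycle-closing (x₀ey , _) =
    Walk-++⁺ H (forward 0 t) _ (x 0) (Walk-forward 0 t ≤-refl) (edge-rotate H x₀ey , _) ,
    sym (trans (first-++ H (forward 0 t) _ (x 0)) (first-forward 0 t))

  length-closing-cycle : ∀ y → length (closing-cycle y) ≡ t + 1
  length-closing-cycle y = trans (length-++ (forward 0 t)) (cong (_+ 1) (length-forward 0 t))

  Unique-∷-closing-cycle : ∀ {w y} → w ≢ y → Outside w → Outside y → Unique (w ∷ vertices H (closing-cycle y))
  Unique-∷-closing-cycle {w} {y} w≢y out-w out-y = Unique-resp-↭ (↭-sym (begin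
      w ∷ vertices H (closing-cycle y)
    ≡⟨ cong (w ∷_) (vertices-++ H (forward 0 t) _) ⟩
      w ∷ vertices H (forward 0 t) ++ x (2 * t) ∷ y ∷ []
    ↭⟨ solve 4 (λ W V X Y → W ⊕ (V ⊕ (X ⊕ Y)) ⊜ W ⊕ (Y ⊕ (V ⊕ X))) ↭-refl
         [ w ] (vertices H (forward 0 t)) [ x (2 * t) ] [ y ] ⟩
      w ∷ y ∷ vertices H (forward 0 t) ∷ʳ x (2 * t)
    ≡⟨ cong (λ vs → w ∷ y ∷ vs) forward∷ʳ≡pathVertices ⟩
      w ∷ y ∷ pathVertices
    ∎))
    (Unique-y∷z∷pathVertices w≢y out-w out-y)
    where open PermutationReasoning

-- The path P of length t = k + 1 + r around its link {x_{2k} , x_{2k+1} , x_{2k+2}}; t is written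
-- suc (k + r) so that the segments forward (suc k) r and backward (suc k) r end exactly at x_{2t}.
module AroundLink {n : ℕ} (H : 3Graph n) (k r : ℕ) (x : ℕ → Fin n) (P : IsLinearPath H (suc (k + r)) x) where
  open OnPath H (suc (k + r)) x P
  open import Algebra.Solver.CommutativeMonoid (++-commutativeMonoid {A = Fin n}) using (solve; _⊕_; _⊜_)

  private
    t : ℕ
    t = suc (k + r)

    x₀ a b c e : Fin n
    x₀ = x 0
    a = x (2 * k)
    b = x (2 * k + 1)
    c = x (2 * suc k)
    e = x (2 * t)

    L R B₀ B₁ : List (Fin n × Fin n)
    L = forward 0 k
    R = forward (suc k) r
    B₀ = backward 0 k
    B₁ = backward (suc k) r

    k≤t : k ≤ t
    k≤t = ≤-trans (m≤m+n k r) (n≤1+n (k + r))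

    k+2+r≡t+1 : k + suc (suc r) ≡ t + 1
    k+2+r≡t+1 = arith k r
      where
      arith : ∀ k r → k + suc (suc r) ≡ suc (k + r) + 1
      arith = solve-∀

    k+[r+1]+1≡t+1 : k + suc (r + 1) ≡ t + 1
    k+[r+1]+1≡t+1 = trans (cong (k +_) (cong suc (+-comm r 1))) k+2+r≡t+1

  x[2k+2]≡c : x (2 * k + 2) ≡ c
  x[2k+2]≡c = cong x (arith k)
    where
    arith : ∀ k → 2 * k + 2 ≡ 2 * suc k
    arith = solve-∀

  pathVertices-split : pathVertices ≡ vertices H L ++ a ∷ b ∷ vertices H R ∷ʳ e
  pathVertices-split = begin
      pathVertices
    ≡⟨ sym forward∷ʳ≡pathVertices ⟩
      vertices H (forward 0 t) ∷ʳ e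
    ≡⟨ cong (λ ls → vertices H ls ∷ʳ e) (trans (cong (forward 0) (sym (+-suc k r))) (forward-++ 0 k (suc r))) ⟩
      vertices H (L ++ (a , b) ∷ R) ∷ʳ e
    ≡⟨ cong (_∷ʳ e) (vertices-++ H L ((a , b) ∷ R)) ⟩
      (vertices H L ++ a ∷ b ∷ vertices H R) ∷ʳ e
    ≡⟨ ++-assoc (vertices H L) _ [ e ] ⟩
      vertices H L ++ a ∷ b ∷ vertices H R ∷ʳ e
    ∎
    where open ≡-Reasoning

  -- x_{2k} … x_0 y x_{2k+1} z x_{2t} … x_{2k+2}
  path-ii : ∀ {y z} → y ≢ z → Joins 0 (2 * k + 1) y → Joins (2 * t) (2 * k + 1) z → LinearPath H (t + 1)
  path-ii {y} {z} y≢z (x₀by , out-y) (ebz , out-z) =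
    subst (LinearPath H) len
      (Walk⇒LinearPath H ls c walk (Unique-resp-↭ (↭-sym perm) (Unique-y∷z∷pathVertices y≢z out-y out-z)))
    where
    ls : List (Fin n × Fin n)
    ls = B₀ ++ (x₀ , y) ∷ (b , z) ∷ B₁
    walk : Walk H ls c
    walk = Walk-++⁺ H B₀ _ c (Walk-backward 0 k k≤t)
      (edge-swap₂₃ H x₀by ,
       subst (λ v → edge H b z v ≡ true) (sym (first-backward (suc k) r)) (edge-rotate H ebz) ,
       Walk-backward (suc k) r ≤-refl)
    len : length ls ≡ t + 1
    len = trans (length-++ B₀)
      (trans (cong₂ (λ i j → i + suc (suc j)) (length-backward 0 k) (length-backward (suc k) r)) k+2+r≡t+1)
    perm : vertices H ls ∷ʳ c ↭ y ∷ z ∷ pathVertices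
    perm = begin
        vertices H ls ∷ʳ c
      ≡⟨ cong (_∷ʳ c) (vertices-++ H B₀ _) ⟩
        (vertices H B₀ ++ x₀ ∷ y ∷ b ∷ z ∷ vertices H B₁) ∷ʳ c
      ↭⟨ solve 7 (λ V₀ X₀ Y B Z V₁ C →
           (V₀ ⊕ (X₀ ⊕ (Y ⊕ (B ⊕ (Z ⊕ V₁))))) ⊕ C ⊜ Y ⊕ (Z ⊕ ((X₀ ⊕ V₀) ⊕ (B ⊕ (C ⊕ V₁)))))
           ↭-refl (vertices H B₀) [ x₀ ] [ y ] [ b ] [ z ] (vertices H B₁) [ c ] ⟩
        y ∷ z ∷ (x₀ ∷ vertices H B₀) ++ b ∷ c ∷ vertices H B₁
      ↭⟨ ↭-prep y (↭-prep z (++⁺ (x[2a]∷backward↭forward∷ʳ 0 k)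
           (↭-prep b (x[2a]∷backward↭forward∷ʳ (suc k) r)))) ⟩
        y ∷ z ∷ (vertices H L ∷ʳ a) ++ b ∷ vertices H R ∷ʳ e
      ≡⟨ cong (λ vs → y ∷ z ∷ vs) (trans (++-assoc (vertices H L) [ a ] _) (sym pathVertices-split)) ⟩
        y ∷ z ∷ pathVertices
      ∎
      where open PermutationReasoning

  Walk-detour : ∀ {y} → edge H (x (2 * k)) (x (2 * k + 2)) y ≡ true → Walk H ((a , y) ∷ R) e
  Walk-detour {y} acy =
    subst (λ v → edge H a y v ≡ true) (sym (first-forward (suc k) r))
      (edge-swap₂₃ H (subst (λ v → edge H a v y ≡ true) x[2k+2]≡c acy)) ,
    Walk-forward (suc k) r ≤-refl

  -- z x_{2k+1} x_0 … x_{2k} y x_{2k+2} … x_{2t}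
  path-iv₀ : ∀ {y z} → y ≢ z → Joins (2 * k) (2 * k + 2) y → Joins 0 (2 * k + 1) z → LinearPath H (t + 1)
  path-iv₀ {y} {z} y≢z (acy , out-y) (x₀bz , out-z) =
    subst (LinearPath H) len
      (Walk⇒LinearPath H ls e walk (Unique-resp-↭ (↭-sym perm) (Unique-y∷z∷pathVertices y≢z out-y out-z)))
    where
    ls : List (Fin n × Fin n)
    ls = (z , b) ∷ L ++ (a , y) ∷ R
    walk : Walk H ls e
    walk = subst (λ v → edge H z b v ≡ true) (sym (trans (first-++ H L _ e) (first-forward 0 k)))
             (edge-reverse H x₀bz) ,
           Walk-++⁺ H L _ e (Walk-forward 0 k k≤t) (Walk-detour acy)
    len : length ls ≡ t + 1
    len = trans (cong suc (length-++ L))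
      (trans (cong₂ (λ i j → suc (i + suc j)) (length-forward 0 k) (length-forward (suc k) r))
        (trans (sym (+-suc k (suc r))) k+2+r≡t+1))
    perm : vertices H ls ∷ʳ e ↭ y ∷ z ∷ pathVertices
    perm = begin
        z ∷ b ∷ vertices H (L ++ (a , y) ∷ R) ∷ʳ e
      ≡⟨ cong (λ vs → z ∷ b ∷ vs ∷ʳ e) (vertices-++ H L _) ⟩
        z ∷ b ∷ (vertices H L ++ a ∷ y ∷ vertices H R) ∷ʳ e
      ↭⟨ solve 7 (λ Z B VL A Y VR E →
           Z ⊕ (B ⊕ ((VL ⊕ (A ⊕ (Y ⊕ VR))) ⊕ E)) ⊜ Y ⊕ (Z ⊕ (VL ⊕ (A ⊕ (B ⊕ (VR ⊕ E))))))
           ↭-refl [ z ] [ b ] (vertices H L) [ a ] [ y ] (vertices H R) [ e ] ⟩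
        y ∷ z ∷ vertices H L ++ a ∷ b ∷ vertices H R ∷ʳ e
      ≡⟨ cong (λ vs → y ∷ z ∷ vs) (sym pathVertices-split) ⟩
        y ∷ z ∷ pathVertices
      ∎
      where open PermutationReasoning

  -- x_0 … x_{2k} y x_{2k+2} … x_{2t} x_{2k+1} z
  path-ivₜ : ∀ {y z} → y ≢ z → Joins (2 * k) (2 * k + 2) y → Joins (2 * t) (2 * k + 1) z → LinearPath H (t + 1)
  path-ivₜ {y} {z} y≢z (acy , out-y) (ebz , out-z) =
    subst (LinearPath H) len
      (Walk⇒LinearPath H ls z walk (Unique-resp-↭ (↭-sym perm) (Unique-y∷z∷pathVertices y≢z out-y out-z)))
    where
    ls : List (Fin n × Fin n)
    ls = L ++ (a , y) ∷ R ++ [ (e , b) ]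
    walk : Walk H ls z
    walk = Walk-++⁺ H L _ z (Walk-forward 0 k k≤t)
             (Walk-++⁺ H ((a , y) ∷ R) [ (e , b) ] z (Walk-detour acy) (ebz , _))
    len : length ls ≡ t + 1
    len = trans (length-++ L) (trans (cong (λ i → length L + suc i) (length-++ R))
      (trans (cong₂ (λ i j → i + suc (j + 1)) (length-forward 0 k) (length-forward (suc k) r)) k+[r+1]+1≡t+1))
    perm : vertices H ls ∷ʳ z ↭ y ∷ z ∷ pathVertices
    perm = begin
        vertices H ls ∷ʳ z
      ≡⟨ cong (_∷ʳ z)
           (trans (vertices-++ H L _) (cong (λ vs → vertices H L ++ a ∷ y ∷ vs) (vertices-++ H R _))) ⟩
        (vertices H L ++ a ∷ y ∷ vertices H R ++ e ∷ b ∷ []) ∷ʳ z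
      ↭⟨ solve 7 (λ VL A Y VR E B Z →
           (VL ⊕ (A ⊕ (Y ⊕ (VR ⊕ (E ⊕ B))))) ⊕ Z ⊜ Y ⊕ (Z ⊕ (VL ⊕ (A ⊕ (B ⊕ (VR ⊕ E))))))
           ↭-refl (vertices H L) [ a ] [ y ] (vertices H R) [ e ] [ b ] [ z ] ⟩
        y ∷ z ∷ vertices H L ++ a ∷ b ∷ vertices H R ∷ʳ e
      ≡⟨ cong (λ vs → y ∷ z ∷ vs) (sym pathVertices-split) ⟩
        y ∷ z ∷ pathVertices
      ∎
      where open PermutationReasoning

  -- x_0 … x_{2k} z x_{2t} … x_{2k+2} y x_0, a (t + 1)-cycle avoiding x_{2k+1}
  cycle-iii : Fin n → Fin n → List (Fin n × Fin n)
  cycle-iii y z = L ++ (a , z) ∷ B₁ ++ [ (c , y) ]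

  edge-c-y-x₀ : ∀ {y} → Joins 0 (2 * k + 2) y → edge H c y x₀ ≡ true
  edge-c-y-x₀ (x₀cy , _) = subst (λ v → edge H v _ x₀ ≡ true) x[2k+2]≡c (edge-rotate H x₀cy)

  edge-a-z-e : ∀ {y z} → Joins (2 * t) (2 * k) z → edge H a z (first H (B₁ ++ [ (c , y) ]) x₀) ≡ true
  edge-a-z-e {y} (eaz , _) =
    subst (λ v → edge H a _ v ≡ true) (sym (trans (first-++ H B₁ [ (c , y) ] x₀) (first-backward (suc k) r)))
      (edge-rotate H eaz)

  Cycle-iii : ∀ {y z} → Joins 0 (2 * k + 2) y → Joins (2 * t) (2 * k) z → Cycle H (cycle-iii y z) x₀
  Cycle-iii {y} jy jz =
    Walk-++⁺ H L _ x₀ (Walk-forward 0 k k≤t)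
      (edge-a-z-e jz , Walk-++⁺ H B₁ [ (c , y) ] x₀ (Walk-backward (suc k) r ≤-refl) (edge-c-y-x₀ jy , _)) ,
    sym (trans (first-++ H L _ x₀) (first-forward 0 k))

  length-cycle-iii : ∀ y z → length (cycle-iii y z) ≡ t + 1
  length-cycle-iii y z = trans (length-++ L) (trans (cong (λ i → length L + suc i) (length-++ B₁))
    (trans (cong₂ (λ i j → i + suc (j + 1)) (length-forward 0 k) (length-backward (suc k) r)) k+[r+1]+1≡t+1))

  Unique-∷-cycle-iii : ∀ {w y z} → Unique (w ∷ y ∷ z ∷ []) → All Outside (w ∷ y ∷ z ∷ []) →
    Unique (w ∷ vertices H (cycle-iii y z))
  Unique-∷-cycle-iii {w} {y} {z} u outs =
    AllPairs.tail (Unique-resp-↭ (↭-sym perm) (Unique-++-pathVertices _ outs u))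
    where
    perm : b ∷ w ∷ vertices H (cycle-iii y z) ↭ w ∷ y ∷ z ∷ pathVertices
    perm = begin
        b ∷ w ∷ vertices H (cycle-iii y z)
      ≡⟨ cong (λ vs → b ∷ w ∷ vs)
           (trans (vertices-++ H L _) (cong (λ vs → vertices H L ++ a ∷ z ∷ vs) (vertices-++ H B₁ _))) ⟩
        b ∷ w ∷ vertices H L ++ a ∷ z ∷ vertices H B₁ ++ c ∷ y ∷ []
      ↭⟨ solve 8 (λ B W VL A Z V₁ C Y →
           B ⊕ (W ⊕ (VL ⊕ (A ⊕ (Z ⊕ (V₁ ⊕ (C ⊕ Y)))))) ⊜ W ⊕ (Y ⊕ (Z ⊕ (VL ⊕ (A ⊕ (B ⊕ (C ⊕ V₁)))))))
           ↭-refl [ b ] [ w ] (vertices H L) [ a ] [ z ] (vertices H B₁) [ c ] [ y ] ⟩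
        w ∷ y ∷ z ∷ vertices H L ++ a ∷ b ∷ c ∷ vertices H B₁
      ↭⟨ ↭-prep w (↭-prep y (↭-prep z (++⁺ˡ (vertices H L) (↭-prep a (↭-prep b
           (x[2a]∷backward↭forward∷ʳ (suc k) r)))))) ⟩
        w ∷ y ∷ z ∷ vertices H L ++ a ∷ b ∷ vertices H R ∷ʳ e
      ≡⟨ cong (λ vs → w ∷ y ∷ z ∷ vs) (sym pathVertices-split) ⟩
        w ∷ y ∷ z ∷ pathVertices
      ∎
      where open PermutationReasoning

  module _ (3≤t : 3 ≤ t) (δ : ∀ v → twiceG n t ≤ 2 * deg H v) (noPath : ¬ LinearPath H (t + 1)) where

    y-replaceable-contradiction : ∀ y₁ y₂ z → y₁ ≢ y₂ → y₁ ≢ z → y₂ ≢ z →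
      Joins 0 (2 * k + 2) y₁ → Joins 0 (2 * k + 2) y₂ → Joins (2 * t) (2 * k) z → ⊥
    y-replaceable-contradiction y₁ y₂ z y₁≢y₂ y₁≢z y₂≢z j₁@(_ , out₁) j₂@(_ , out₂) jz@(_ , out-z) =
      swapped-vertex-contradiction H t 3≤t δ noPath (L ++ (a , z) ∷ B₁) [] c y₁ y₂ x₀
        (subst (λ ls → Cycle H ls x₀) reassoc (Cycle-iii j₁ jz))
        (edge-c-y-x₀ j₂)
        (subst (λ ls → Unique (y₂ ∷ vertices H ls)) reassoc
          (Unique-∷-cycle-iii (((y₁≢y₂ ∘ sym) ∷ y₂≢z ∷ []) ∷ (y₁≢z ∷ []) ∷ [] ∷ [])
            (out₂ ∷ out₁ ∷ out-z ∷ [])))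
        (trans (cong length (sym reassoc)) (length-cycle-iii y₁ z))
      where
      reassoc : cycle-iii y₁ z ≡ (L ++ (a , z) ∷ B₁) ++ [ (c , y₁) ]
      reassoc = sym (++-assoc L ((a , z) ∷ B₁) [ (c , y₁) ])

    z-replaceable-contradiction : ∀ z₁ z₂ y → z₁ ≢ z₂ → z₁ ≢ y → z₂ ≢ y →
      Joins (2 * t) (2 * k) z₁ → Joins (2 * t) (2 * k) z₂ → Joins 0 (2 * k + 2) y → ⊥
    z-replaceable-contradiction z₁ z₂ y z₁≢z₂ z₁≢y z₂≢y j₁@(_ , out₁) j₂@(_ , out₂) jy@(_ , out-y) =
      swapped-vertex-contradiction H t 3≤t δ noPath L (B₁ ++ [ (c , y) ]) a z₁ z₂ x₀
        (Cycle-iii jy j₁) (edge-a-z-e j₂)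
        (Unique-∷-cycle-iii ((z₂≢y ∷ (z₁≢z₂ ∘ sym) ∷ []) ∷ ((z₁≢y ∘ sym) ∷ []) ∷ [] ∷ [])
          (out₂ ∷ out-y ∷ out₁ ∷ []))
        (length-cycle-iii y z₁)

module _ {n : ℕ} (H : 3Graph n) (t : ℕ) (x : ℕ → Fin n) (P : IsLinearPath H t x) where

  dP[0,2t]≤1 : 3 ≤ t → (∀ v → twiceG n t ≤ 2 * deg H v) → ¬ LinearPath H (t + 1) → dP H t x 0 (2 * t) ≤ 1
  dP[0,2t]≤1 3≤t δ noPath = dP≤1 λ y₁ y₂ y₁≢y₂ j₁@(_ , out₁) (x₀ey₂ , out₂) →
    swapped-vertex-contradiction H t 3≤t δ noPath (forward 0 t) [] (x (2 * t)) y₁ y₂ (x 0)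
      (Cycle-closing j₁) (edge-rotate H x₀ey₂) (Unique-∷-closing-cycle (y₁≢y₂ ∘ sym) out₂ out₁)
      (length-closing-cycle y₁)
    where open OnPath H t x P

  dP[0,2k+1]+dP[2t,2k+1]≤2 : ¬ LinearPath H (t + 1) → ∀ k → k < t →
    0 < dP H t x 0 (2 * k + 1) → 0 < dP H t x (2 * t) (2 * k + 1) →
    dP H t x 0 (2 * k + 1) + dP H t x (2 * t) (2 * k + 1) ≤ 2
  dP[0,2k+1]+dP[2t,2k+1]≤2 noPath k k<t with m≤n⇒∃[o]m+o≡n k<t
  ... | r , refl = OnPath.dP+dP≤2 H _ x P λ y≢z jy jz → noPath (AroundLink.path-ii H k r x P y≢z jy jz)

  dP[0,2k+2]+dP[2t,2k]≤4 : 3 ≤ t → (∀ v → twiceG n t ≤ 2 * deg H v) → ¬ LinearPath H (t + 1) →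
    ∀ k → k < t → 0 < dP H t x 0 (2 * k + 2) → 0 < dP H t x (2 * t) (2 * k) →
    dP H t x 0 (2 * k + 2) + dP H t x (2 * t) (2 * k) ≤ 4
  dP[0,2k+2]+dP[2t,2k]≤4 3≤t δ noPath k k<t with m≤n⇒∃[o]m+o≡n k<t
  ... | r , refl = OnPath.dP+dP≤4 H _ x P
    (AroundLink.y-replaceable-contradiction H k r x P 3≤t δ noPath)
    (AroundLink.z-replaceable-contradiction H k r x P 3≤t δ noPath)

  dP[2k,2k+2]+dP[2ℓ,2k+1]≤2 : ¬ LinearPath H (t + 1) → ∀ k ℓ → k < t → (ℓ ≡ 0 ⊎ ℓ ≡ t) →
    0 < dP H t x (2 * k) (2 * k + 2) → 0 < dP H t x (2 * ℓ) (2 * k + 1) →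
    dP H t x (2 * k) (2 * k + 2) + dP H t x (2 * ℓ) (2 * k + 1) ≤ 2
  dP[2k,2k+2]+dP[2ℓ,2k+1]≤2 noPath k ℓ k<t ℓ∈ with m≤n⇒∃[o]m+o≡n k<t | ℓ∈
  ... | r , refl | inj₁ refl =
    OnPath.dP+dP≤2 H _ x P λ y≢z jy jz → noPath (AroundLink.path-iv₀ H k r x P y≢z jy jz)
  ... | r , refl | inj₂ refl =
    OnPath.dP+dP≤2 H _ x P λ y≢z jy jz → noPath (AroundLink.path-ivₜ H k r x P y≢z jy jz)

lemma2p3 : (t n : ℕ) → 3 ≤ t → 2 * t + 17 ≤ n →
    (H : 3Graph n) → (∀ v → twiceG n t ≤ 2 * deg H v) →
    ¬ (Σ (ℕ → Fin n) (λ z → IsLinearPath H (t + 1) z)) →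
    (x : ℕ → Fin n) → IsLinearPath H t x →
    (dP H t x 0 (2 * t) ≤ 1)
    × (∀ k → k < t → 0 < dP H t x 0 (2 * k + 1) → 0 < dP H t x (2 * t) (2 * k + 1) →
         dP H t x 0 (2 * k + 1) + dP H t x (2 * t) (2 * k + 1) ≤ 2)
    × (∀ k → k < t → 0 < dP H t x 0 (2 * k + 2) → 0 < dP H t x (2 * t) (2 * k) →
         dP H t x 0 (2 * k + 2) + dP H t x (2 * t) (2 * k) ≤ 4)
    × (∀ k ℓ → k < t → (ℓ ≡ 0 ⊎ ℓ ≡ t) →
         0 < dP H t x (2 * k) (2 * k + 2) → 0 < dP H t x (2 * ℓ) (2 * k + 1) →
         dP H t x (2 * k) (2 * k + 2) + dP H t x (2 * ℓ) (2 * k + 1) ≤ 2)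
lemma2p3 t n 3≤t _ H δ noPath x P =
  dP[0,2t]≤1 H t x P 3≤t δ noPath ,
  dP[0,2k+1]+dP[2t,2k+1]≤2 H t x P noPath ,
  dP[0,2k+2]+dP[2t,2k]≤4 H t x P 3≤t δ noPath ,
  dP[2k,2k+2]+dP[2ℓ,2k+1]≤2 H t x P noPath
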